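{- Let $m,k$ be positive integers with $1\le k\le 2m+1$. If there exists a $k$-extended Langford sequence of defect $4$ and length $m$, then there exist $2m+1$ QMR$^*(3,3,3)$s such that the $27(2m+1)$ entries of all of them are pairwise distinct and together form exactly the set $S=[-4,4]\cup[32,40+27m]\cup[-40-27m,-32]$.
   Context: For integers $a\le b$, $[a,b]$ denotes $\{a,\dots,b\}$. A $k$-extended Langford sequence of defect $d$ and length $m$ is a sequence $(l_1,\dots,l_{2m+1})$ in which position $l_k$ is empty and every other term lies in $\{d,\dots,d+m-1\}$, each such $j$ occurring exactly twice with its two occurrences at positions $a$ and $a+j$; equivalently a partition of $[1,2m+1]\setminus\{k\}$ into pairs with differences $d,d+1,\dots,d+m-1$. A QMR$^*(3,3)$ is a $3\times 3$ array of distinct integers in which every row sum and every column sum equals $0$. A QMR$^*(3,3,3)$ is an ordered triple of QMR$^*(3,3)$s whose $27$ entries are pairwise distinct and such that, for each position $(i,j)$, the sum of the three $(i,j)$-entries of the three arrays is $0$. -}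

module Defs where

open import Data.Nat as ℕ using (ℕ; suc)
open import Data.Integer as ℤ using (ℤ; +_; -_; _+_)
open import Data.Fin using (Fin; toℕ; zero; suc)
open import Data.Maybe using (Maybe; just; nothing)
open import Data.Product using (Σ; ∃; ∃-syntax; _×_)
open import Data.Sum using (_⊎_)
open import Relation.Binary.PropositionalEquality using (_≡_; _≢_)

-- The sequence (l_1, ..., l_{2m+1}) is represented by
-- seq : Fin (2m+1) → Maybe ℕ, where Fin index p stands for position toℕ p + 1
-- and 'nothing' means the position is empty.
record ExtLangford (k d m : ℕ) : Set where
  field
    seq   : Fin (2 ℕ.* m ℕ.+ 1) → Maybe ℕ
    hole  : ∀ p → toℕ p ℕ.+ 1 ≡ k → seq p ≡ nothing
    terms : ∀ p → toℕ p ℕ.+ 1 ≢ k →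
              ∃[ j ] (seq p ≡ just j × d ℕ.≤ j × j ℕ.< d ℕ.+ m)
    pairs : ∀ j → d ℕ.≤ j → j ℕ.< d ℕ.+ m →
              Σ (Fin (2 ℕ.* m ℕ.+ 1)) λ a → Σ (Fin (2 ℕ.* m ℕ.+ 1)) λ b →
                toℕ b ≡ toℕ a ℕ.+ j × seq a ≡ just j × seq b ≡ just j ×
                (∀ p → seq p ≡ just j → p ≡ a ⊎ p ≡ b)

Array : Set
Array = Fin 3 → Fin 3 → ℤ

record IsQMR33 (A : Array) : Set where
  field
    distinct : ∀ i j i' j' → A i j ≡ A i' j' → i ≡ i' × j ≡ j'
    rowSum   : ∀ i → A i zero + A i (suc zero) + A i (suc (suc zero)) ≡ + 0
    colSum   : ∀ j → A zero j + A (suc zero) j + A (suc (suc zero)) j ≡ + 0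

record IsQMR333 (T : Fin 3 → Array) : Set where
  field
    each     : ∀ t → IsQMR33 (T t)
    distinct : ∀ t i j t' i' j' → T t i j ≡ T t' i' j' →
                 t ≡ t' × i ≡ i' × j ≡ j'
    posSum   : ∀ i j → T zero i j + T (suc zero) i j + T (suc (suc zero)) i j ≡ + 0

InS : ℕ → ℤ → Set
InS m z = (- (+ 4) ℤ.≤ z × z ℤ.≤ + 4)
        ⊎ (+ 32 ℤ.≤ z × z ℤ.≤ + (40 ℕ.+ 27 ℕ.* m))
        ⊎ (- (+ (40 ℕ.+ 27 ℕ.* m)) ℤ.≤ z × z ℤ.≤ - (+ 32))

module Submission where

-- Every entry is
-- entry c u = 9c + u - 4 for a "centre" c ∈ ℤ and a digit u < 9, and (c, u) is
-- determined by the entry. S is exactly the set of entries whose centre lies in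
--      Centre m = {0} ∪ {c : 4 ≤ |c| ≤ 4+3m}. A linear Latin cube over ℤ₃ gives each cell (t,i,j) a symbol s and a digit
--      u, bijectively; along every line the symbols are a permutation of 0,1,2 and
--      the digits sum to 12.  So for a zero-sum triple X of distinct centres,
--      "block X" : (t,i,j) ↦ entry (X s) u is a QMR*(3,3,3). Blocks of zero-sum triples with pairwise distinct centres are therefore
--      QMR*(3,3,3)s with distinct entries, covering the expansion of the centres. The Langford sequence supplies 2m+1 such triples (4+m+p, ±j or 0, -(4+m+p'))
--      for each position p with partner p', and their centres are exactly Centre m.

open import Defs
open import Data.Nat using (ℕ; _≤_; _+_; _*_)
open import Data.Integer using (ℤ)
open import Data.Fin using (Fin)
open import Data.Product using (Σ; ∃; ∃-syntax; _×_)
open import Function.Bundles using (_⇔_)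
open import Relation.Binary.PropositionalEquality using (_≡_)

open import Data.Nat as ℕ using (suc; zero; z≤n; s≤s; _<_; _∸_; _%_; _/_; _⊔_; _≟_; _≤?_)
import Data.Nat.Properties as ℕP
open import Data.Nat.DivMod using (_mod_; m≡m%n+[m/n]*n; m%n<n; /-monoˡ-≤; m<n*o⇒m/o<n)
import Data.Nat.Tactic.RingSolver as ℕSolver
open import Data.Integer as ℤ using (+_; +[1+_]; -[1+_]; ∣_∣; _⊖_; +≤+)
import Data.Integer.Properties as ℤP
open import Data.Integer.Tactic.RingSolver using (solve-∀)
open import Data.Fin as F using (toℕ; fromℕ<)
open import Data.Fin.Properties using (all?; toℕ-injective; toℕ<n; toℕ-fromℕ<)
open import Data.Maybe using (just)
open import Data.Product using (_,_; proj₁; proj₂)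
open import Data.Product.Properties using (≡-dec)
open import Data.Sum using (_⊎_; inj₁; inj₂)
open import Data.Empty using (⊥-elim)
open import Data.List using (List; _∷_; [])
open import Data.List.Relation.Unary.Any using (here; there)
open import Data.List.Membership.Propositional using (_∈_)
open import Data.List.Membership.DecPropositional using (_∈?_)
open import Function.Bundles using (mk⇔; Equivalence)
import Function.Properties.Equivalence as ⇔
open import Relation.Nullary using (Dec; yes; no)
open import Relation.Nullary.Decidable using (toWitness; _×-dec_)
open import Relation.Binary.Definitions using (DecidableEquality)
open import Relation.Binary.PropositionalEquality using (refl; sym; trans; cong; cong₂; subst; _≢_; module ≡-Reasoning)
open import Algebra.Properties.CommutativeSemigroup ℤP.+-commutativeSemigroup
  using (xy∙z≈xz∙y; xy∙z≈yx∙z; xy∙z≈zx∙y; xy∙z≈yz∙x; xy∙z≈zy∙x)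

pattern 0F = F.zero
pattern 1F = F.suc F.zero
pattern 2F = F.suc (F.suc F.zero)

entry : ℤ → ℕ → ℤ
entry c u = + 9 ℤ.* c ℤ.+ + u ℤ.- + 4

-- An entry determines its centre and its digit: 9(c - c') is a difference of
-- two digits, hence at most 8 in absolute value, hence 0.
entry-injective : ∀ {c c' u u'} → u < 9 → u' < 9 → entry c u ≡ entry c' u' → c ≡ c' × u ≡ u'
entry-injective {c} {c'} {u} {u'} u<9 u'<9 eq = c≡c' , ℤP.+-injective (sym (ℤP.i-j≡0⇒i≡j (+ u') (+ u) digits-agree))
  where
  expand : ∀ c c' u u' → + 9 ℤ.* (c ℤ.- c') ≡ ((+ 9 ℤ.* c ℤ.+ u ℤ.- + 4) ℤ.- (+ 9 ℤ.* c' ℤ.+ u' ℤ.- + 4)) ℤ.+ (u' ℤ.- u)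
  expand = solve-∀
  scaled : + 9 ℤ.* (c ℤ.- c') ≡ + u' ℤ.- + u
  scaled = begin
    + 9 ℤ.* (c ℤ.- c')                                ≡⟨ expand c c' (+ u) (+ u') ⟩
    (entry c u ℤ.- entry c' u') ℤ.+ (+ u' ℤ.- + u)    ≡⟨ cong (λ x → (x ℤ.- entry c' u') ℤ.+ (+ u' ℤ.- + u)) eq ⟩
    (entry c' u' ℤ.- entry c' u') ℤ.+ (+ u' ℤ.- + u)  ≡⟨ cong (ℤ._+ (+ u' ℤ.- + u)) (ℤP.+-inverseʳ (entry c' u')) ⟩
    + 0 ℤ.+ (+ u' ℤ.- + u)                            ≡⟨ ℤP.+-identityˡ _ ⟩
    + u' ℤ.- + u                                      ∎
    where open ≡-Reasoning
  bounded : 9 * ∣ c ℤ.- c' ∣ ≤ 8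
  bounded = begin
    9 * ∣ c ℤ.- c' ∣        ≡⟨ sym (ℤP.abs-* (+ 9) (c ℤ.- c')) ⟩
    ∣ + 9 ℤ.* (c ℤ.- c') ∣  ≡⟨ cong ∣_∣ (trans scaled (ℤP.m-n≡m⊖n u' u)) ⟩
    ∣ u' ⊖ u ∣              ≤⟨ ℤP.∣m⊝n∣≤m⊔n u' u ⟩
    u' ⊔ u                  ≤⟨ ℕP.⊔-lub (ℕ.s≤s⁻¹ u'<9) (ℕ.s≤s⁻¹ u<9) ⟩
    8                       ∎
    where open ℕP.≤-Reasoning
  small-multiple : ∀ n → 9 * n ≤ 8 → n ≡ 0
  small-multiple zero    _  = refl
  small-multiple (suc n) le = ⊥-elim (ℕP.<-irrefl refl (ℕP.≤-trans (ℕP.*-monoʳ-≤ 9 (s≤s (z≤n {n}))) le))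
  c≡c' : c ≡ c'
  c≡c' = ℤP.i-j≡0⇒i≡j c c' (ℤP.∣i∣≡0⇒i≡0 (small-multiple _ bounded))
  digits-agree : + u' ℤ.- + u ≡ + 0
  digits-agree = begin
    + u' ℤ.- + u          ≡⟨ sym scaled ⟩
    + 9 ℤ.* (c ℤ.- c')    ≡⟨ cong (λ x → + 9 ℤ.* (x ℤ.- c')) c≡c' ⟩
    + 9 ℤ.* (c' ℤ.- c')   ≡⟨ cong (+ 9 ℤ.*_) (ℤP.+-inverseʳ c') ⟩
    + 0                   ∎
    where open ≡-Reasoning

entry-neg : ∀ c {u} → u < 9 → entry (ℤ.- c) u ≡ ℤ.- entry c (8 ∸ u)
entry-neg c {u} u<9 = begin
  entry (ℤ.- c) u                              ≡⟨ mirror c (+ u) ⟩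
  ℤ.- (+ 9 ℤ.* c ℤ.+ (+ 8 ℤ.- + u) ℤ.- + 4)    ≡⟨ cong (λ x → ℤ.- (+ 9 ℤ.* c ℤ.+ x ℤ.- + 4)) complement ⟩
  ℤ.- entry c (8 ∸ u)                          ∎
  where
  open ≡-Reasoning
  mirror : ∀ c u → + 9 ℤ.* ℤ.- c ℤ.+ u ℤ.- + 4 ≡ ℤ.- (+ 9 ℤ.* c ℤ.+ (+ 8 ℤ.- u) ℤ.- + 4)
  mirror = solve-∀
  complement : + 8 ℤ.- + u ≡ + (8 ∸ u)
  complement = trans (ℤP.m-n≡m⊖n 8 u) (ℤP.⊖-≥ (ℕ.s≤s⁻¹ u<9))

complement<9 : ∀ u → 8 ∸ u < 9
complement<9 u = s≤s (ℕP.m∸n≤m 8 u)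

entry-pos : ∀ q u → 4 ≤ 9 * q + u → entry (+ q) u ≡ + (9 * q + u ∸ 4)
entry-pos q u le = begin
  + 9 ℤ.* + q ℤ.+ + u ℤ.- + 4  ≡⟨ cong (λ x → x ℤ.+ + u ℤ.- + 4) (sym (ℤP.pos-* 9 q)) ⟩
  (9 * q + u) ⊖ 4              ≡⟨ ℤP.⊖-≥ le ⟩
  + (9 * q + u ∸ 4)            ∎
  where open ≡-Reasoning

Band : ℕ → ℕ → Set
Band m q = 4 ≤ q × q ≤ 4 + 3 * m

Centre : ℕ → ℤ → Set
Centre m c = c ≡ + 0 ⊎ Band m ∣ c ∣

Expand : (ℤ → Set) → ℤ → Set
Expand C z = ∃[ c ] ∃[ u ] (C c × u < 9 × entry c u ≡ z)

zero-window : ∀ {u} → u < 9 → (ℤ.- + 4 ℤ.≤ entry (+ 0) u) × (entry (+ 0) u ℤ.≤ + 4)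
zero-window {u} u<9 = ℤP.+-monoˡ-≤ (ℤ.- + 4) {+ 0} {+ u} (+≤+ z≤n) , ℤP.+-monoˡ-≤ (ℤ.- + 4) {+ u} {+ 8} (+≤+ (ℕ.s≤s⁻¹ u<9))

band-window : ∀ m {q u} → Band m q → u < 9 → (+ 32 ℤ.≤ entry (+ q) u) × (entry (+ q) u ℤ.≤ + (40 + 27 * m))
band-window m {q} {u} (lo , hi) u<9 =
  subst InRange (sym (entry-pos q u (ℕP.≤-trans (s≤s (s≤s (s≤s (s≤s z≤n)))) 36≤)))
        (+≤+ (ℕP.∸-monoˡ-≤ 4 36≤) , +≤+ (ℕP.∸-monoˡ-≤ 4 upper))
  where
  InRange : ℤ → Set
  InRange x = (+ 32 ℤ.≤ x) × (x ℤ.≤ + (40 + 27 * m))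
  36≤ : 36 ≤ 9 * q + u
  36≤ = ℕP.≤-trans (ℕP.*-monoʳ-≤ 9 lo) (ℕP.m≤m+n (9 * q) u)
  top : ∀ m → 9 * (4 + 3 * m) + 8 ≡ 4 + (40 + 27 * m)
  top = ℕSolver.solve-∀
  upper : 9 * q + u ≤ 4 + (40 + 27 * m)
  upper = ℕP.≤-trans (ℕP.+-mono-≤ (ℕP.*-monoʳ-≤ 9 hi) (ℕ.s≤s⁻¹ u<9)) (ℕP.≤-reflexive (top m))

entry∈S : ∀ m {c u} → Centre m c → u < 9 → InS m (entry c u)
entry∈S m {+ 0}      _           u<9 = inj₁ (zero-window u<9)
entry∈S m {+[1+ n ]} (inj₂ band) u<9 = inj₂ (inj₁ (band-window m band u<9))
entry∈S m { -[1+ n ]} {u} (inj₂ band) u<9 rewrite entry-neg +[1+ n ] u<9 =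
  inj₂ (inj₂ (ℤP.neg-mono-≤ (proj₂ window) , ℤP.neg-mono-≤ (proj₁ window)))
  where
  window : (+ 32 ℤ.≤ entry +[1+ n ] (8 ∸ u)) × (entry +[1+ n ] (8 ∸ u) ℤ.≤ + (40 + 27 * m))
  window = band-window m band (complement<9 u)
entry∈S m {+[1+ n ]}  (inj₁ ())
entry∈S m { -[1+ n ]} (inj₁ ())

zero-decompose : ∀ {z} → ℤ.- + 4 ℤ.≤ z → z ℤ.≤ + 4 → ∃[ u ] (u < 9 × entry (+ 0) u ≡ z)
zero-decompose {z} lo hi = ∣ z ℤ.+ + 4 ∣ , s≤s (ℤP.drop‿+≤+ (subst (ℤ._≤ + 8) (sym shifted) (ℤP.+-monoˡ-≤ (+ 4) hi))) , back
  where
  shifted : + ∣ z ℤ.+ + 4 ∣ ≡ z ℤ.+ + 4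
  shifted = ℤP.0≤i⇒+∣i∣≡i (ℤP.+-monoˡ-≤ (+ 4) lo)
  undo : ∀ z → z ℤ.+ + 4 ℤ.- + 4 ≡ z
  undo = solve-∀
  back : entry (+ 0) ∣ z ℤ.+ + 4 ∣ ≡ z
  back = trans (cong (ℤ._- + 4) shifted) (undo z)

band-decompose : ∀ m {w} → + 32 ℤ.≤ w → w ℤ.≤ + (40 + 27 * m) → ∃[ q ] ∃[ u ] (Band m q × u < 9 × entry (+ q) u ≡ w)
band-decompose m {+ n} (+≤+ lo) (+≤+ hi) = q , u , (q≥4 , q≤) , m%n<n (n + 4) 9 , value
  where
  q u : ℕ
  q = (n + 4) / 9
  u = (n + 4) % 9
  division : 9 * q + u ≡ n + 4
  division = trans (trans (ℕP.+-comm (9 * q) u) (cong (λ x → u + x) (ℕP.*-comm 9 q))) (sym (m≡m%n+[m/n]*n (n + 4) 9))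
  q≥4 : 4 ≤ q
  q≥4 = /-monoˡ-≤ 9 (ℕP.+-monoˡ-≤ 4 lo)
  top : ∀ m → suc (40 + 27 * m + 4) ≡ (5 + 3 * m) * 9
  top = ℕSolver.solve-∀
  q≤ : q ≤ 4 + 3 * m
  q≤ = ℕ.s≤s⁻¹ (m<n*o⇒m/o<n (subst (suc (n + 4) ≤_) (top m) (s≤s (ℕP.+-monoˡ-≤ 4 hi))))
  value : entry (+ q) u ≡ + n
  value = trans (entry-pos q u (subst (4 ≤_) (sym division) (ℕP.m≤n+m 4 n)))
                (cong +_ (trans (cong (_∸ 4) division) (ℕP.m+n∸n≡m n 4)))

S-expansion : ∀ m z → InS m z ⇔ Expand (Centre m) z
S-expansion m z = mk⇔ decompose (λ { (c , u , c∈C , u<9 , refl) → entry∈S m c∈C u<9 })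
  where
  decompose : InS m z → Expand (Centre m) z
  decompose (inj₁ (lo , hi)) with zero-decompose lo hi
  ... | u , u<9 , eq = + 0 , u , inj₁ refl , u<9 , eq
  decompose (inj₂ (inj₁ (lo , hi))) with band-decompose m lo hi
  ... | q , u , band , u<9 , eq = + q , u , inj₂ band , u<9 , eq
  decompose (inj₂ (inj₂ (lo , hi))) with band-decompose m (ℤP.neg-mono-≤ hi) (ℤP.neg-mono-≤ lo)
  ... | q , u , band , u<9 , eq =
    ℤ.- + q , 8 ∸ u , inj₂ (subst (Band m) (sym (ℤP.∣-i∣≡∣i∣ (+ q))) band) , complement<9 u , mirrored
    where
    open ≡-Reasoning
    mirrored : entry (ℤ.- + q) (8 ∸ u) ≡ z
    mirrored = begin
      entry (ℤ.- + q) (8 ∸ u)       ≡⟨ entry-neg (+ q) (complement<9 u) ⟩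
      ℤ.- entry (+ q) (8 ∸ (8 ∸ u)) ≡⟨ cong (λ v → ℤ.- entry (+ q) v) (ℕP.m∸[m∸n]≡n (ℕ.s≤s⁻¹ u<9)) ⟩
      ℤ.- entry (+ q) u             ≡⟨ cong ℤ.-_ eq ⟩
      ℤ.- ℤ.- z                     ≡⟨ ℤP.neg-involutive z ⟩
      z                             ∎

-- Cell (t,i,j) gets the digit a + 3b and the symbol s, where
-- (a, b, s) = (t+i+j, t+i+2j, t+2i+j) mod 3; this linear map of ℤ₃³ is
-- invertible with inverse (t, i, j) = (2b+2s, s+2a, b+2a).
symbol : Fin 3 → Fin 3 → Fin 3 → Fin 3
symbol t i j = (toℕ t + 2 * toℕ i + toℕ j) mod 3

digit : Fin 3 → Fin 3 → Fin 3 → ℕ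
digit t i j = (toℕ t + toℕ i + toℕ j) % 3 + 3 * ((toℕ t + toℕ i + 2 * toℕ j) % 3)

Triple : Set
Triple = Fin 3 × Fin 3 × Fin 3

_≟₃_ : DecidableEquality Triple
_≟₃_ = ≡-dec F._≟_ (≡-dec F._≟_ F._≟_)

uncube : ℕ → Fin 3 → Triple
uncube u s = (2 * b + 2 * toℕ s) mod 3 , (toℕ s + 2 * a) mod 3 , (b + 2 * a) mod 3
  where
  a b : ℕ
  a = u % 3
  b = u / 3

symbolAt : Triple → Fin 3
symbolAt (t , i , j) = symbol t i j

digitAt : Triple → ℕ
digitAt (t , i , j) = digit t i j

digit<9 : ∀ t i j → digit t i j < 9
digit<9 = toWitness {a? = all? λ t → all? λ i → all? λ j → digit t i j ℕ.<? 9} _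

uncube-cube : ∀ t i j → uncube (digit t i j) (symbol t i j) ≡ (t , i , j)
uncube-cube = toWitness {a? = all? λ t → all? λ i → all? λ j → uncube (digit t i j) (symbol t i j) ≟₃ (t , i , j)} _

cube-uncube : ∀ (d : Fin 9) s → symbolAt (uncube (toℕ d) s) ≡ s × digitAt (uncube (toℕ d) s) ≡ toℕ d
cube-uncube = toWitness {a? = all? λ d → all? λ s → (symbolAt (uncube (toℕ d) s) F.≟ s) ×-dec (digitAt (uncube (toℕ d) s) ≟ toℕ d)} _

cube-injective : ∀ t i j t' i' j' → symbol t i j ≡ symbol t' i' j' → digit t i j ≡ digit t' i' j' → t ≡ t' × i ≡ i' × j ≡ j'
cube-injective t i j t' i' j' s≡ d≡ =
  components (trans (sym (uncube-cube t i j)) (trans (cong₂ uncube d≡ s≡) (uncube-cube t' i' j')))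
  where
  components : (t , i , j) ≡ (t' , i' , j') → t ≡ t' × i ≡ i' × j ≡ j'
  components refl = refl , refl , refl

cube-surjective : ∀ s {u} → u < 9 → ∃[ c ] (symbolAt c ≡ s × digitAt c ≡ u)
cube-surjective s u<9 = uncube (toℕ (fromℕ< u<9)) s , proj₁ found , trans (proj₂ found) (toℕ-fromℕ< u<9)
  where found = cube-uncube (fromℕ< u<9) s

permutations : List Triple
permutations = (0F , 1F , 2F) ∷ (0F , 2F , 1F) ∷ (1F , 0F , 2F) ∷ (1F , 2F , 0F) ∷ (2F , 0F , 1F) ∷ (2F , 1F , 0F) ∷ []

-- A line is a sequence of three cells; it is balanced when its symbols form a
-- permutation of 0,1,2 and its digits sum to 12 (a third of 0 + 1 + ... + 8).
Line : Set
Line = Fin 3 → Triple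

Balanced : Line → Set
Balanced ℓ = (symbolAt (ℓ 0F) , symbolAt (ℓ 1F) , symbolAt (ℓ 2F)) ∈ permutations ×
             digitAt (ℓ 0F) + digitAt (ℓ 1F) + digitAt (ℓ 2F) ≡ 12

balanced? : ∀ ℓ → Dec (Balanced ℓ)
balanced? ℓ = _∈?_ _≟₃_ (symbolAt (ℓ 0F) , symbolAt (ℓ 1F) , symbolAt (ℓ 2F)) permutations
              ×-dec (digitAt (ℓ 0F) + digitAt (ℓ 1F) + digitAt (ℓ 2F) ≟ 12)

rows-balanced : ∀ t i → Balanced (λ j → t , i , j)
rows-balanced = toWitness {a? = all? λ t → all? λ i → balanced? (λ j → t , i , j)} _

columns-balanced : ∀ t j → Balanced (λ i → t , i , j)
columns-balanced = toWitness {a? = all? λ t → all? λ j → balanced? (λ i → t , i , j)} _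

piles-balanced : ∀ i j → Balanced (λ t → t , i , j)
piles-balanced = toWitness {a? = all? λ i → all? λ j → balanced? (λ t → t , i , j)} _

permutation-sum : ∀ (X : Fin 3 → ℤ) {a b c} → (a , b , c) ∈ permutations → X a ℤ.+ X b ℤ.+ X c ≡ X 0F ℤ.+ X 1F ℤ.+ X 2F
permutation-sum X (here refl)                                         = refl
permutation-sum X (there (here refl))                                 = xy∙z≈xz∙y (X 0F) (X 2F) (X 1F)
permutation-sum X (there (there (here refl)))                         = xy∙z≈yx∙z (X 1F) (X 0F) (X 2F)
permutation-sum X (there (there (there (here refl))))                 = xy∙z≈zx∙y (X 1F) (X 2F) (X 0F)
permutation-sum X (there (there (there (there (here refl)))))         = xy∙z≈yz∙x (X 2F) (X 0F) (X 1F)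
permutation-sum X (there (there (there (there (there (here refl)))))) = xy∙z≈zy∙x (X 2F) (X 1F) (X 0F)

cellEntry : (Fin 3 → ℤ) → Triple → ℤ
cellEntry X c = entry (X (symbolAt c)) (digitAt c)

-- Along a balanced line the entries built from a zero-sum triple sum to zero:
-- the sum is 9 (X 0 + X 1 + X 2) + 12 - 3·4.
line-sum : ∀ (X : Fin 3 → ℤ) (ℓ : Line) → X 0F ℤ.+ X 1F ℤ.+ X 2F ≡ + 0 → Balanced ℓ →
           cellEntry X (ℓ 0F) ℤ.+ cellEntry X (ℓ 1F) ℤ.+ cellEntry X (ℓ 2F) ≡ + 0
line-sum X ℓ zero-sum (perm , twelve) = begin
  cellEntry X (ℓ 0F) ℤ.+ cellEntry X (ℓ 1F) ℤ.+ cellEntry X (ℓ 2F)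
    ≡⟨ collect (X (σ 0F)) (X (σ 1F)) (X (σ 2F)) (+ δ 0F) (+ δ 1F) (+ δ 2F) ⟩
  + 9 ℤ.* (X (σ 0F) ℤ.+ X (σ 1F) ℤ.+ X (σ 2F)) ℤ.+ (+ (δ 0F + δ 1F + δ 2F) ℤ.- + 12)
    ≡⟨ cong₂ (λ x y → + 9 ℤ.* x ℤ.+ (y ℤ.- + 12)) (trans (permutation-sum X perm) zero-sum) (cong +_ twelve) ⟩
  + 0 ∎
  where
  open ≡-Reasoning
  σ : Fin 3 → Fin 3
  σ k = symbolAt (ℓ k)
  δ : Fin 3 → ℕ
  δ k = digitAt (ℓ k)
  collect : ∀ x y z a b c → (+ 9 ℤ.* x ℤ.+ a ℤ.- + 4) ℤ.+ (+ 9 ℤ.* y ℤ.+ b ℤ.- + 4) ℤ.+ (+ 9 ℤ.* z ℤ.+ c ℤ.- + 4)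
                          ≡ + 9 ℤ.* (x ℤ.+ y ℤ.+ z) ℤ.+ ((a ℤ.+ b ℤ.+ c) ℤ.- + 12)
  collect = solve-∀

block : (Fin 3 → ℤ) → Fin 3 → Array
block X t i j = cellEntry X (t , i , j)

block-collision : ∀ X Y t i j t' i' j' → block X t i j ≡ block Y t' i' j' →
                  X (symbol t i j) ≡ Y (symbol t' i' j') × digit t i j ≡ digit t' i' j'
block-collision _ _ t i j t' i' j' = entry-injective (digit<9 t i j) (digit<9 t' i' j')

block-isQMR333 : ∀ (X : Fin 3 → ℤ) → X 0F ℤ.+ X 1F ℤ.+ X 2F ≡ + 0 → (∀ {s s'} → X s ≡ X s' → s ≡ s') → IsQMR333 (block X)
block-isQMR333 X zero-sum X-injective = record
  { each     = λ t → record
      { distinct = λ i j i' j' e → proj₂ (distinct-cells t i j t i' j' e)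
      ; rowSum   = λ i → line-sum X (λ j → t , i , j) zero-sum (rows-balanced t i)
      ; colSum   = λ j → line-sum X (λ i → t , i , j) zero-sum (columns-balanced t j) }
  ; distinct = distinct-cells
  ; posSum   = λ i j → line-sum X (λ t → t , i , j) zero-sum (piles-balanced i j) }
  where
  distinct-cells : ∀ t i j t' i' j' → block X t i j ≡ block X t' i' j' → t ≡ t' × i ≡ i' × j ≡ j'
  distinct-cells t i j t' i' j' e = let (same-centre , same-digit) = block-collision X X t i j t' i' j' e
                                 in cube-injective t i j t' i' j' (X-injective same-centre) same-digit

module BlowUp {P : Set} (centre : P → Fin 3 → ℤ)
              (zero-sum : ∀ p → centre p 0F ℤ.+ centre p 1F ℤ.+ centre p 2F ≡ + 0)
              (centre-injective : ∀ {p s p' s'} → centre p s ≡ centre p' s' → p ≡ p' × s ≡ s') where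

  Q : P → Fin 3 → Array
  Q p = block (centre p)

  Q-isQMR333 : ∀ p → IsQMR333 (Q p)
  Q-isQMR333 p = block-isQMR333 (centre p) (zero-sum p) (λ e → proj₂ (centre-injective e))

  Q-injective : ∀ r t i j r' t' i' j' → Q r t i j ≡ Q r' t' i' j' → r ≡ r' × t ≡ t' × i ≡ i' × j ≡ j'
  Q-injective r t i j r' t' i' j' e =
    proj₁ same-position , cube-injective t i j t' i' j' (proj₂ same-position) (proj₂ collision)
    where
    collision : centre r (symbol t i j) ≡ centre r' (symbol t' i' j') × digit t i j ≡ digit t' i' j'
    collision = block-collision (centre r) (centre r') t i j t' i' j' e
    same-position : r ≡ r' × symbol t i j ≡ symbol t' i' j'
    same-position = centre-injective (proj₁ collision)

  hit : ∀ p s {u} → u < 9 → ∃[ r ] ∃[ t ] ∃[ i ] ∃[ j ] Q r t i j ≡ entry (centre p s) u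
  hit p s {u} u<9 = realise (cube-surjective s u<9)
    where
    realise : ∃[ c ] (symbolAt c ≡ s × digitAt c ≡ u) → ∃[ r ] ∃[ t ] ∃[ i ] ∃[ j ] Q r t i j ≡ entry (centre p s) u
    realise ((t , i , j) , s≡ , u≡) = p , t , i , j , cong₂ (λ s' u' → entry (centre p s') u') s≡ u≡

  Q-image : (C : ℤ → Set) → (∀ c → C c ⇔ (∃[ p ] ∃[ s ] centre p s ≡ c)) →
            ∀ z → Expand C z ⇔ (∃[ r ] ∃[ t ] ∃[ i ] ∃[ j ] Q r t i j ≡ z)
  Q-image C image z = mk⇔ to from
    where
    to : Expand C z → ∃[ r ] ∃[ t ] ∃[ i ] ∃[ j ] Q r t i j ≡ z
    to (c , u , c∈C , u<9 , refl) with Equivalence.to (image c) c∈C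
    ... | p , s , refl = hit p s u<9
    from : (∃[ r ] ∃[ t ] ∃[ i ] ∃[ j ] Q r t i j ≡ z) → Expand C z
    from (r , t , i , j , refl) =
      centre r (symbol t i j) , digit t i j , Equivalence.from (image _) (r , symbol t i j , refl) , digit<9 t i j , refl

hole-position : ∀ {n k} → 1 ≤ k → k ≤ n → Σ (Fin n) λ p → toℕ p + 1 ≡ k
hole-position {k = suc k'} (s≤s z≤n) k≤n = fromℕ< k≤n , trans (cong (λ x → x + 1) (toℕ-fromℕ< k≤n)) (ℕP.+-comm k' 1)

module LangfordCentres {m k : ℕ} (k≥1 : 1 ≤ k) (k≤ : k ≤ 2 * m + 1) (L : ExtLangford k 4 m) where
  open ExtLangford L

  Pos : Set
  Pos = Fin (2 * m + 1)

  position≤ : ∀ p → toℕ p ≤ 2 * m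
  position≤ p = ℕ.s≤s⁻¹ (subst (suc (toℕ p) ≤_) (ℕP.+-comm (2 * m) 1) (toℕ<n p))

  below-length : ∀ {x} → x ≤ 2 * m → x < 2 * m + 1
  below-length x≤ = ℕP.≤-<-trans x≤ (ℕP.m<m+n (2 * m) (s≤s z≤n))

  record Pair (j : ℕ) (a b : Pos) : Set where
    constructor pair
    field
      first  : seq a ≡ just j
      second : seq b ≡ just j
      gap    : toℕ b ≡ toℕ a + j
  open Pair

  filled-not-hole : ∀ {p j} → seq p ≡ just j → toℕ p + 1 ≢ k
  filled-not-hole {p} sp h with trans (sym sp) (hole p h)
  ... | ()

  value-range : ∀ {p j} → seq p ≡ just j → 4 ≤ j × j < 4 + m
  value-range {p} sp with terms p (filled-not-hole sp)
  ... | _ , sp' , lo , hi with trans (sym sp) sp'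
  ...   | refl = lo , hi

  value-band : ∀ {p j} → seq p ≡ just j → Band m j
  value-band sp with value-range sp
  ... | lo , hi = lo , ℕP.≤-trans (ℕP.<⇒≤ hi) (ℕP.+-monoʳ-≤ 4 (ℕP.m≤m+n m (2 * m)))

  same-value : ∀ {p j j'} → seq p ≡ just j → seq p ≡ just j' → j ≡ j'
  same-value sp sp' with trans (sym sp) sp'
  ... | refl = refl

  no-shift : ∀ {n j} → 0 < j → n ≢ n + j
  no-shift {n} (s≤s _) e = ℕP.m+1+n≢m n (sym e)

  -- Any pair of value j is the pair promised by the sequence: its two
  -- positions are occurrences of j, and they cannot coincide or be swapped.
  pair-unique : ∀ {j a b a' b'} → Pair j a b → Pair j a' b' → a ≡ a' × b ≡ b'
  pair-unique {j} pr pr' with value-range (first pr)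
  ... | lo , hi with pairs j lo hi
  ... | a₀ , b₀ , gap₀ , _ , _ , only = combine (canonical pr) (canonical pr')
    where
    positive : 0 < j
    positive = ℕP.≤-trans (s≤s z≤n) lo
    canonical : ∀ {a b} → Pair j a b → a ≡ a₀ × b ≡ b₀
    canonical (pair sa sb gap) with only _ sa | only _ sb
    ... | inj₁ refl | inj₂ refl = refl , refl
    ... | inj₁ refl | inj₁ refl = ⊥-elim (no-shift positive gap)
    ... | inj₂ refl | inj₂ refl = ⊥-elim (no-shift positive gap)
    ... | inj₂ refl | inj₁ refl =
      ⊥-elim (no-shift (ℕP.≤-trans positive (ℕP.m≤m+n j j)) (trans gap (trans (cong (λ x → x + j) gap₀) (ℕP.+-assoc (toℕ a₀) j j))))
    combine : ∀ {a b a' b'} → a ≡ a₀ × b ≡ b₀ → a' ≡ a₀ × b' ≡ b₀ → a ≡ a' × b ≡ b'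
    combine (refl , refl) (refl , refl) = refl , refl

  pair-distinct : ∀ {j a b} → Pair (suc j) a b → a ≢ b
  pair-distinct pr refl = no-shift (s≤s z≤n) (gap pr)

  data Role (p : Pos) : Set where
    empty  : toℕ p + 1 ≡ k → Role p
    opener : ∀ {j} (b : Pos) → Pair (suc j) p b → Role p
    closer : ∀ {j} (a : Pos) → Pair (suc j) a p → Role p

  role : ∀ p → Role p
  role p with toℕ p + 1 ≟ k
  ... | yes h = empty h
  ... | no h with terms p h
  ...   | zero , _ , () , _
  ...   | suc j , sp , lo , hi with pairs (suc j) lo hi
  ...     | a , b , gap , sa , sb , only with only p sp
  ...       | inj₁ refl = opener b (pair sa sb gap)
  ...       | inj₂ refl = closer a (pair sa sb gap)

  signed : ∀ {p} → Role p → ℤ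
  signed (empty _)        = + 0
  signed (opener {j} _ _) = +[1+ j ]
  signed (closer {j} _ _) = -[1+ j ]

  partner : ∀ {p} → Role p → Pos
  partner {p} (empty _) = p
  partner (opener b _)  = b
  partner (closer a _)  = a

  E : Pos → ℤ
  E p = signed (role p)

  σ : Pos → Pos
  σ p = partner (role p)

  opener-role : ∀ {p b j} (κ : Role p) → Pair (suc j) p b → signed κ ≡ +[1+ j ] × partner κ ≡ b
  opener-role (empty h) pr = ⊥-elim (filled-not-hole (first pr) h)
  opener-role (opener _ pr') pr with same-value (first pr') (first pr)
  ... | refl = refl , proj₂ (pair-unique pr' pr)
  opener-role (closer _ pr') pr with same-value (second pr') (first pr)
  ... | refl = ⊥-elim (pair-distinct pr (proj₂ (pair-unique pr' pr)))

  closer-role : ∀ {p a j} (κ : Role p) → Pair (suc j) a p → signed κ ≡ -[1+ j ] × partner κ ≡ a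
  closer-role (empty h) pr = ⊥-elim (filled-not-hole (second pr) h)
  closer-role (opener _ pr') pr with same-value (first pr') (second pr)
  ... | refl = ⊥-elim (pair-distinct pr' (proj₂ (pair-unique pr pr')))
  closer-role (closer _ pr') pr with same-value (second pr') (second pr)
  ... | refl = refl , proj₁ (pair-unique pr' pr)

  hole-role : ∀ {p} (κ : Role p) → toℕ p + 1 ≡ k → signed κ ≡ + 0 × partner κ ≡ p
  hole-role (empty _)     _ = refl , refl
  hole-role (opener _ pr) h = ⊥-elim (filled-not-hole (first pr) h)
  hole-role (closer _ pr) h = ⊥-elim (filled-not-hole (second pr) h)

  σ-involutive : ∀ p → σ (σ p) ≡ p
  σ-involutive p = returns (role p)
    where
    returns : (κ : Role p) → σ (partner κ) ≡ p
    returns (empty h)     = proj₂ (hole-role (role p) h)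
    returns (opener b pr) = proj₂ (closer-role (role b) pr)
    returns (closer a pr) = proj₂ (opener-role (role a) pr)

  σ-injective : ∀ {p p'} → σ p ≡ σ p' → p ≡ p'
  σ-injective {p} {p'} e = trans (sym (σ-involutive p)) (trans (cong σ e) (σ-involutive p'))

  lift : Pos → ℕ
  lift p = 4 + m + toℕ p

  lift-injective : ∀ {p p'} → lift p ≡ lift p' → p ≡ p'
  lift-injective e = toℕ-injective (ℕP.+-cancelˡ-≡ (4 + m) _ _ e)

  lift-band : ∀ p → Band m (lift p)
  lift-band p = ℕP.≤-trans (ℕP.m≤m+n 4 m) (ℕP.m≤m+n (4 + m) (toℕ p)) , ℕP.+-monoʳ-≤ (4 + m) (position≤ p)

  balance : ∀ {p} (κ : Role p) → + lift p ℤ.+ signed κ ≡ + lift (partner κ)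
  balance (empty _) = cong +_ (ℕP.+-identityʳ _)
  balance {p} (opener {j} b pr) = cong +_ (trans (ℕP.+-assoc (4 + m) (toℕ p) (suc j)) (cong (λ x → 4 + m + x) (sym (gap pr))))
  balance {p} (closer {j} a pr) = begin
    + lift p ℤ.+ -[1+ j ]                     ≡⟨ cong (λ x → + (4 + m + x) ℤ.+ -[1+ j ]) (gap pr) ⟩
    + (4 + m + (toℕ a + suc j)) ℤ.+ -[1+ j ]  ≡⟨ cong (λ x → + x ℤ.+ -[1+ j ]) (sym (ℕP.+-assoc (4 + m) (toℕ a) (suc j))) ⟩
    + lift a ℤ.+ +[1+ j ] ℤ.- +[1+ j ]        ≡⟨ cancel (+ lift a) +[1+ j ] ⟩
    + lift a                                  ∎
    where
    open ≡-Reasoning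
    cancel : ∀ x y → x ℤ.+ y ℤ.- y ≡ x
    cancel = solve-∀

  centre : Pos → Fin 3 → ℤ
  centre p 0F = + lift p
  centre p 1F = E p
  centre p 2F = ℤ.- + lift (σ p)

  zero-sum : ∀ p → centre p 0F ℤ.+ centre p 1F ℤ.+ centre p 2F ≡ + 0
  zero-sum p = trans (cong (ℤ._- + lift (σ p)) (balance (role p))) (ℤP.+-inverseʳ (+ lift (σ p)))

  -- Signed values are distinct: each value j occurs in one pair only.
  signed-injective : ∀ {p p'} (κ : Role p) (κ' : Role p') → signed κ ≡ signed κ' → p ≡ p'
  signed-injective (empty h)     (empty h')     _    = toℕ-injective (ℕP.+-cancelʳ-≡ 1 _ _ (trans h (sym h')))
  signed-injective (opener _ pr) (opener _ pr') refl = proj₁ (pair-unique pr pr')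
  signed-injective (closer _ pr) (closer _ pr') refl = proj₂ (pair-unique pr pr')
  signed-injective (empty _)     (opener _ _)   ()
  signed-injective (empty _)     (closer _ _)   ()
  signed-injective (opener _ _)  (empty _)      ()
  signed-injective (opener _ _)  (closer _ _)   ()
  signed-injective (closer _ _)  (empty _)      ()
  signed-injective (closer _ _)  (opener _ _)   ()

  signed-small : ∀ {p} (κ : Role p) → ∣ signed κ ∣ < 4 + m
  signed-small (empty _)     = s≤s z≤n
  signed-small (opener _ pr) = proj₂ (value-range (first pr))
  signed-small (closer _ pr) = proj₂ (value-range (first pr))

  large-not-signed : ∀ p {q} (κ : Role q) → lift p ≢ ∣ signed κ ∣
  large-not-signed p κ e = ℕP.m+n≮m (4 + m) (toℕ p) (subst (_< 4 + m) (sym e) (signed-small κ))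

  centre-injective : ∀ {p s p' s'} → centre p s ≡ centre p' s' → p ≡ p' × s ≡ s'
  centre-injective {p} {0F} {p'} {0F} e = lift-injective (ℤP.+-injective e) , refl
  centre-injective {p} {0F} {p'} {1F} e = ⊥-elim (large-not-signed p (role p') (cong ∣_∣ e))
  centre-injective {p} {1F} {p'} {0F} e = ⊥-elim (large-not-signed p' (role p) (cong ∣_∣ (sym e)))
  centre-injective {p} {1F} {p'} {1F} e = signed-injective (role p) (role p') e , refl
  centre-injective {p} {1F} {p'} {2F} e = ⊥-elim (large-not-signed (σ p') (role p) (cong ∣_∣ (sym e)))
  centre-injective {p} {2F} {p'} {1F} e = ⊥-elim (large-not-signed (σ p) (role p') (cong ∣_∣ e))
  centre-injective {p} {2F} {p'} {2F} e = σ-injective (lift-injective (ℤP.+-injective (ℤP.neg-injective e))) , refl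
  centre-injective {_} {0F} {_}  {2F} ()
  centre-injective {_} {2F} {_}  {0F} ()

  signed-centre : ∀ {p} (κ : Role p) → Centre m (signed κ)
  signed-centre (empty _)     = inj₁ refl
  signed-centre (opener _ pr) = inj₂ (value-band (first pr))
  signed-centre (closer _ pr) = inj₂ (value-band (first pr))

  centre-within : ∀ p s → Centre m (centre p s)
  centre-within p 0F = inj₂ (lift-band p)
  centre-within p 1F = signed-centre (role p)
  centre-within p 2F = inj₂ (lift-band (σ p))

  large-position : ∀ {q} → 4 + m ≤ q → q ≤ 4 + 3 * m → Σ Pos λ p → lift p ≡ q
  large-position {q} large hi = fromℕ< x< , trans (cong (λ x → 4 + m + x) (toℕ-fromℕ< x<)) (ℕP.m+[n∸m]≡n large)
    where
    x< : q ∸ (4 + m) < 2 * m + 1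
    x< = below-length (ℕP.m≤n+o⇒m∸n≤o q (4 + m) {2 * m} hi)

  cover-band : ∀ {q} → Band m q → (∃[ p ] ∃[ s ] centre p s ≡ + q) × (∃[ p ] ∃[ s ] centre p s ≡ ℤ.- + q)
  cover-band {zero} (() , _)
  cover-band {suc j} (lo , hi) with 4 + m ≤? suc j
  ... | yes large with large-position large hi
  ...   | p , lift-p = (p , 0F , cong +_ lift-p) ,
                       (σ p , 2F , cong (λ n → ℤ.- + n) (trans (cong lift (σ-involutive p)) lift-p))
  cover-band {suc j} (lo , hi) | no small with pairs (suc j) lo (ℕP.≰⇒> small)
  ... | a , b , gap , sa , sb , _ = (a , 1F , proj₁ (opener-role (role a) (pair sa sb gap))) ,
                                   (b , 1F , proj₁ (closer-role (role b) (pair sa sb gap)))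

  cover : ∀ c → Centre m c → ∃[ p ] ∃[ s ] centre p s ≡ c
  cover (+ 0) _ with hole-position k≥1 k≤
  ... | p , h = p , 1F , proj₁ (hole-role (role p) h)
  cover +[1+ n ] (inj₂ band) = proj₁ (cover-band band)
  cover -[1+ n ] (inj₂ band) = proj₂ (cover-band band)
  cover +[1+ n ] (inj₁ ())
  cover -[1+ n ] (inj₁ ())

  centre-image : ∀ c → Centre m c ⇔ (∃[ p ] ∃[ s ] centre p s ≡ c)
  centre-image c = mk⇔ (cover c) (λ { (p , s , refl) → centre-within p s })

lemma2p2 : (m k : ℕ) → 1 ≤ m → 1 ≤ k → k ≤ 2 * m + 1 →
    ExtLangford k 4 m →
    Σ (Fin (2 * m + 1) → Fin 3 → Array) λ Q →
      (∀ r → IsQMR333 (Q r)) ×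
      (∀ r t i j r' t' i' j' → Q r t i j ≡ Q r' t' i' j' →
         r ≡ r' × t ≡ t' × i ≡ i' × j ≡ j') ×
      (∀ z → InS m z ⇔ (∃[ r ] ∃[ t ] ∃[ i ] ∃[ j ] Q r t i j ≡ z))
lemma2p2 m k _ k≥1 k≤2m+1 L =
  Q , Q-isQMR333 , Q-injective , λ z → ⇔.trans (S-expansion m z) (Q-image (Centre m) centre-image z)
  where
  open LangfordCentres k≥1 k≤2m+1 L
  open BlowUp centre zero-sum centre-injective
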